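{- Let $\sigma$ be a finite sequence of channel actions and $u=\mathrm{rea}(\sigma)$. (i) If $x=u^p$ is a fractional power of $u$, then $\mathrm{pr}[\sigma](x)$ is also a fractional power of $u$, say $\mathrm{pr}[\sigma](u^p)=u^m$. (ii) Furthermore, if $m>1$, then $\mathrm{pr}[\sigma](u^{p+n})=u^{m+n}$ for all $n\in\mathbb{N}$. (iii) Finally, for all $n\in\mathbb{N}$, if $m>n+1$ then $\mathrm{pr}[\sigma](u^{p-n})=u^{m-n}$.
   Context: Channel actions over a finite alphabet $\Sigma$ are $!w$ and $?w$ ($w\in\Sigma^*$). $\mathrm{rea}(?w)=w$, $\mathrm{rea}(!w)=\epsilon$, extended to sequences by concatenation. $\sqsubseteq$ is the scattered subword ordering. Lossy semantics: $x\xrightarrow{!w}y$ iff $y\sqsubseteq xw$, $x\xrightarrow{?w}y$ iff $wy\sqsubseteq x$, extended to sequences by composition. $\uparrow x=\{y : x\sqsubseteq y\}$. $\mathrm{pr}[\sigma](x)$ is the unique word $y$ with $\{z : \exists x'\in\uparrow x,\ z\xrightarrow{\sigma}x'\}=\uparrow y$. For a rational $p\ge0$ with $p|u|\in\mathbb{N}$, $u^p$ is the prefix of length $p|u|$ of $u^{\lceil p\rceil}$ (fractional power), e.g. $(abc)^{11/3}=abcabcabcab$. -}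

module Defs where

open import Data.Nat as ℕ using (ℕ; suc)
open import Data.Integer using (+_; ∣_∣)
open import Data.Fin using (Fin)
open import Data.List using (List; []; _∷_; _++_; take; concat; replicate; length)
open import Data.List.Relation.Binary.Sublist.Propositional using (_⊆_)
open import Relation.Binary.PropositionalEquality using (_≡_)
open import Data.Product using (Σ; _×_)
open import Data.Rational using (ℚ; _/_; _*_; _≤_; 0ℚ; ceiling)

Word : ℕ → Set
Word k = List (Fin k)

data Act (k : ℕ) : Set where
  snd : Word k → Act k
  rcv : Word k → Act k

reaAct : ∀ {k} → Act k → Word k
reaAct (snd w) = []
reaAct (rcv w) = w

rea : ∀ {k} → List (Act k) → Word k
rea [] = []
rea (a ∷ σ) = reaAct a ++ rea σ

-- lossy semantics of a single action:  x -[a]-> y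
Step : ∀ {k} → Act k → Word k → Word k → Set
Step (snd w) x y = y ⊆ (x ++ w)
Step (rcv w) x y = (w ++ y) ⊆ x

Steps : ∀ {k} → List (Act k) → Word k → Word k → Set
Steps [] x y = x ≡ y
Steps (a ∷ σ) x y = Σ _ λ z → Step a x z × Steps σ z y

-- ↑ x  =  { y | x ⊑ y }.
-- IsPr σ x y  :  { z | ∃ x' ∈ ↑x . z -[σ]-> x' }  =  ↑ y,   i.e.  y = pr[σ](x)
-- (y is unique when it exists, by antisymmetry of ⊑).
IsPr : ∀ {k} → List (Act k) → Word k → Word k → Set
IsPr σ x y = ∀ z → ((Σ _ λ x′ → (x ⊆ x′) × Steps σ z x′) → y ⊆ z)
                 × (y ⊆ z → Σ _ λ x′ → (x ⊆ x′) × Steps σ z x′)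

∣_∣ℚ : ∀ {k} → Word k → ℚ
∣ u ∣ℚ = + length u / 1

Exp : ∀ {k} → Word k → ℚ → ℕ → Set
Exp u p ℓ = (0ℚ ≤ p) × (p * ∣ u ∣ℚ ≡ + ℓ / 1)

-- fractional power u^p, given ℓ = p·|u| ∈ ℕ : the prefix of length ℓ of u^⌈p⌉
fpow : ∀ {k} → Word k → ℚ → ℕ → Word k
fpow u p ℓ = take ℓ (concat (replicate ∣ ceiling p ∣ u))

module Submission where

-- pr[σ] can be computed backwards, one action at a time: a receive ?v prepends v, a send !v
-- cuts off the longest suffix that embeds into v. So pr[σ](x) is a prefix of rea(σ)·x, and for
-- x = u^p this is a prefix of u^(p+1), i.e. again a fractional power of u (i). Extra copies of u
-- in front of x travel through this computation (rotated by the receives) and reappear in front of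
-- pr[σ](x), as long as no send has to cut into them. That is guaranteed when pr[σ](x) is longer
-- than u (ii), and also when pr[σ](u^n x) is longer than u^(n+1) (iii).

open import Data.Nat using (ℕ; suc)

module Exponent where
  open import Data.Nat as ℕ using (zero; suc)
  import Data.Nat.Properties as ℕP
  open import Data.Integer as ℤ using (ℤ; +_; -[1+_]; ∣_∣)
  import Data.Integer.Properties as ℤP
  import Data.Integer.DivMod as ℤD
  open import Data.Integer.Tactic.RingSolver using (solve-∀)
  open import Data.Nat.Coprimality using (Coprime)
  open import Data.Rational using (ℚ; mkℚ; _/_; toℚᵘ; _+_; _*_; _-_; _<_; _≤_; 0ℚ; ceiling; *≤*)
  open import Data.Rational.Properties
  open import Data.Rational.Unnormalised as ℚᵘ using (ℚᵘ; mkℚᵘ; *≡*; *<*; _≃_)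
  import Data.Rational.Unnormalised.Properties as ℚᵘP
  open import Data.Product using (Σ; _×_; _,_)
  open import Data.Sum using (_⊎_; inj₁; inj₂)
  open import Relation.Binary.PropositionalEquality

  fromℕ : ℕ → ℚ
  fromℕ n = + n / 1

  private
    ⟦_⟧ : ℕ → ℚᵘ
    ⟦ n ⟧ = mkℚᵘ (+ n) 0

    toℚᵘ-fromℕ : ∀ n → toℚᵘ (fromℕ n) ≃ ⟦ n ⟧
    toℚᵘ-fromℕ n = toℚᵘ-fromℚᵘ ⟦ n ⟧

    ⟦⟧-injective : ∀ {a b} → ⟦ a ⟧ ≃ ⟦ b ⟧ → a ≡ b
    ⟦⟧-injective {a} {b} (*≡* eq) =
      ℤP.+-injective (trans (sym (ℤP.*-identityʳ (+ a))) (trans eq (ℤP.*-identityʳ (+ b))))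

    ⟦⟧-+ : ∀ a b → ⟦ a ⟧ ℚᵘ.+ ⟦ b ⟧ ≃ ⟦ a ℕ.+ b ⟧
    ⟦⟧-+ a b rewrite ℤP.pos-+ a b = *≡* (normalise (+ a) (+ b))
      where
      normalise : ∀ x y → (x ℤ.* + 1 ℤ.+ y ℤ.* + 1) ℤ.* + 1 ≡ (x ℤ.+ y) ℤ.* + 1
      normalise = solve-∀

    ⟦⟧-* : ∀ a b → ⟦ a ⟧ ℚᵘ.* ⟦ b ⟧ ≃ ⟦ a ℕ.* b ⟧
    ⟦⟧-* a b rewrite ℤP.pos-* a b = *≡* refl

  fromℕ-injective : ∀ {a b} → fromℕ a ≡ fromℕ b → a ≡ b
  fromℕ-injective {a} {b} eq = ⟦⟧-injective
    (ℚᵘP.≃-trans (ℚᵘP.≃-sym (toℚᵘ-fromℕ a)) (ℚᵘP.≃-trans (toℚᵘ-cong eq) (toℚᵘ-fromℕ b)))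

  fromℕ-+ : ∀ a b → fromℕ a + fromℕ b ≡ fromℕ (a ℕ.+ b)
  fromℕ-+ a b = toℚᵘ-injective (ℚᵘP.≃-trans (toℚᵘ-homo-+ (fromℕ a) (fromℕ b))
    (ℚᵘP.≃-trans (ℚᵘP.+-cong (toℚᵘ-fromℕ a) (toℚᵘ-fromℕ b))
      (ℚᵘP.≃-trans (⟦⟧-+ a b) (ℚᵘP.≃-sym (toℚᵘ-fromℕ (a ℕ.+ b))))))

  fromℕ-* : ∀ a b → fromℕ a * fromℕ b ≡ fromℕ (a ℕ.* b)
  fromℕ-* a b = toℚᵘ-injective (ℚᵘP.≃-trans (toℚᵘ-homo-* (fromℕ a) (fromℕ b))
    (ℚᵘP.≃-trans (ℚᵘP.*-cong (toℚᵘ-fromℕ a) (toℚᵘ-fromℕ b))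
      (ℚᵘP.≃-trans (⟦⟧-* a b) (ℚᵘP.≃-sym (toℚᵘ-fromℕ (a ℕ.* b))))))

  fromℕ-cancel-< : ∀ {a b} → fromℕ a < fromℕ b → a ℕ.< b
  fromℕ-cancel-< {a} {b} lt
    with ℚᵘP.<-respˡ-≃ (toℚᵘ-fromℕ a) (ℚᵘP.<-respʳ-≃ (toℚᵘ-fromℕ b) (toℚᵘ-mono-< lt))
  ... | *<* lt′ = ℤP.drop‿+<+ (subst₂ ℤ._<_ (ℤP.*-identityʳ (+ a)) (ℤP.*-identityʳ (+ b)) lt′)

  exponent-+ : ∀ {p} L ℓ ℓ′ n → p * fromℕ L ≡ fromℕ ℓ → (p + fromℕ n) * fromℕ L ≡ fromℕ ℓ′ →
               ℓ′ ≡ n ℕ.* L ℕ.+ ℓ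
  exponent-+ {p} L ℓ ℓ′ n e e′ = fromℕ-injective (begin
    fromℕ ℓ′                              ≡⟨ e′ ⟨
    (p + fromℕ n) * fromℕ L               ≡⟨ *-distribʳ-+ (fromℕ L) p (fromℕ n) ⟩
    p * fromℕ L + fromℕ n * fromℕ L       ≡⟨ cong₂ _+_ e (fromℕ-* n L) ⟩
    fromℕ ℓ + fromℕ (n ℕ.* L)             ≡⟨ +-comm (fromℕ ℓ) _ ⟩
    fromℕ (n ℕ.* L) + fromℕ ℓ             ≡⟨ fromℕ-+ (n ℕ.* L) ℓ ⟩
    fromℕ (n ℕ.* L ℕ.+ ℓ)                 ∎)
    where open ≡-Reasoning

  exponent-< : ∀ {m} k L l → fromℕ k < m → m * fromℕ L ≡ fromℕ l → L ≡ 0 ⊎ k ℕ.* L ℕ.< l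
  exponent-< k zero     l _  _ = inj₁ refl
  exponent-< k (suc L′) l lt e = inj₂ (fromℕ-cancel-<
    (subst₂ _<_ (fromℕ-* k (suc L′)) e (*-monoˡ-<-pos (fromℕ (suc L′)) {{normalize-pos (suc L′) 1}} lt)))

  exponent-exists : ∀ L l → (L ≡ 0 → l ≡ 0) → Σ ℚ λ m → 0ℚ ≤ m × m * fromℕ L ≡ fromℕ l
  exponent-exists zero l l≡0 rewrite l≡0 refl = 0ℚ , ≤-refl , *-zeroˡ (fromℕ 0)
  exponent-exists (suc L′) l _ =
    m , nonNegative⁻¹ m {{normalize-nonNeg l (suc L′)}} , toℚᵘ-injective (ℚᵘP.≃-trans
      (toℚᵘ-homo-* m (fromℕ (suc L′)))
      (ℚᵘP.≃-trans (ℚᵘP.*-cong (toℚᵘ-fromℚᵘ (mkℚᵘ (+ l) L′)) (toℚᵘ-fromℕ (suc L′)))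
        (ℚᵘP.≃-trans cancel (ℚᵘP.≃-sym (toℚᵘ-fromℕ l)))))
    where
    m = + l / suc L′
    cancel : mkℚᵘ (+ l) L′ ℚᵘ.* ⟦ suc L′ ⟧ ≃ ⟦ l ⟧
    cancel = *≡* (trans (ℤP.*-identityʳ _) (cong (λ z → + l ℤ.* + z) (sym (ℕP.*-identityʳ (suc L′)))))

  private
    mkℚ-exponent : ∀ a d L ℓ .(c : Coprime a (suc d)) →
                   mkℚ (+ a) d c * fromℕ L ≡ fromℕ ℓ → a ℕ.* L ≡ ℓ ℕ.* suc d
    mkℚ-exponent a d L ℓ c e
      with ℚᵘP.≃-trans (ℚᵘP.≃-sym (ℚᵘP.*-cong (ℚᵘP.≃-refl {mkℚᵘ (+ a) d}) (toℚᵘ-fromℕ L)))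
             (ℚᵘP.≃-trans (ℚᵘP.≃-sym (toℚᵘ-homo-* (mkℚ (+ a) d c) (fromℕ L)))
               (ℚᵘP.≃-trans (toℚᵘ-cong e) (toℚᵘ-fromℕ ℓ)))
    ... | *≡* e′ = ℤP.+-injective (begin
      + (a ℕ.* L)             ≡⟨ ℤP.pos-* a L ⟩
      + a ℤ.* + L             ≡⟨ ℤP.*-identityʳ _ ⟨
      + a ℤ.* + L ℤ.* + 1     ≡⟨ e′ ⟩
      + ℓ ℤ.* + (suc d ℕ.* 1) ≡⟨ cong (λ z → + ℓ ℤ.* + z) (ℕP.*-identityʳ (suc d)) ⟩
      + ℓ ℤ.* + suc d         ≡⟨ ℤP.pos-* ℓ (suc d) ⟨
      + (ℓ ℕ.* suc d)         ∎)
      where open ≡-Reasoning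

    -- ⌈n/d⌉ = -⌊-n/d⌋, and writing -n = r + q d with r ≥ 0 gives (-q) d = n + r ≥ n.
    negated-quotient : ∀ x r q n → x ≡ r ℤ.+ q ℤ.* n → (ℤ.- q) ℤ.* n ≡ ℤ.- x ℤ.+ r
    negated-quotient x r q n refl = normalise r q n
      where
      normalise : ∀ r q n → (ℤ.- q) ℤ.* n ≡ ℤ.- (r ℤ.+ q ℤ.* n) ℤ.+ r
      normalise = solve-∀

    ≤-∣∣* : ∀ {n r} d (z : ℤ) → z ℤ.* + suc d ≡ + (n ℕ.+ r) → n ℕ.≤ ∣ z ∣ ℕ.* suc d
    ≤-∣∣* {n} {r} d (+ z) e = ℕP.≤-trans (ℕP.m≤m+n n r)
      (ℕP.≤-reflexive (sym (ℤP.+-injective (trans (ℤP.pos-* z (suc d)) e))))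
    ≤-∣∣* d -[1+ _ ] ()

    numerator≤ceiling*denominator : ∀ a d .(c : Coprime a (suc d)) →
                                    a ℕ.≤ ∣ ceiling (mkℚ (+ a) d c) ∣ ℕ.* suc d
    numerator≤ceiling*denominator zero    d c = ℕ.z≤n
    numerator≤ceiling*denominator (suc a) d c =
      ≤-∣∣* d (ℤ.- q) (negated-quotient -[1+ a ] (+ r) q (+ suc d) (ℤD.a≡a%n+[a/n]*n -[1+ a ] (+ suc d)))
      where
      q = -[1+ a ] ℤ./ + suc d
      r = -[1+ a ] ℤD.% + suc d

  exponent≤ceiling : ∀ {p} L ℓ → 0ℚ ≤ p → p * fromℕ L ≡ fromℕ ℓ → ℓ ℕ.≤ ∣ ceiling p ∣ ℕ.* L
  exponent≤ceiling {mkℚ (+ a) d c} L ℓ _ e = ℕP.*-cancelʳ-≤ ℓ (C ℕ.* L) (suc d) (begin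
    ℓ ℕ.* suc d           ≡⟨ mkℚ-exponent a d L ℓ c e ⟨
    a ℕ.* L               ≤⟨ ℕP.*-monoˡ-≤ L (numerator≤ceiling*denominator a d c) ⟩
    C ℕ.* suc d ℕ.* L     ≡⟨ ℕP.*-assoc C (suc d) L ⟩
    C ℕ.* (suc d ℕ.* L)   ≡⟨ cong (C ℕ.*_) (ℕP.*-comm (suc d) L) ⟩
    C ℕ.* (L ℕ.* suc d)   ≡⟨ ℕP.*-assoc C L (suc d) ⟨
    C ℕ.* L ℕ.* suc d     ∎)
    where
    open ℕP.≤-Reasoning
    C = ∣ ceiling (mkℚ (+ a) d c) ∣
  exponent≤ceiling {mkℚ -[1+ _ ] _ _} _ _ (*≤* ()) _

  open import Algebra.Properties.Group +-0-group using (//-rightDividesˡ)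

  -+-cancel : ∀ p q → p - q + q ≡ p
  -+-cancel p q = //-rightDividesˡ q p

module Repetition {A : Set} where
  open import Data.Nat using (zero; suc; _+_; _*_; _∸_; _≤_; s≤s)
  import Data.Nat.Properties as ℕP
  open import Data.List using (List; []; _∷_; _++_; take; concat; replicate; length)
  import Data.List.Properties as LP
  open import Data.Sum using (inj₁; inj₂)
  open import Relation.Binary.PropositionalEquality

  rep : ℕ → List A → List A
  rep n u = concat (replicate n u)

  length-rep : ∀ n (u : List A) → length (rep n u) ≡ n * length u
  length-rep zero    u = refl
  length-rep (suc n) u = trans (LP.length-++ u) (cong (length u +_) (length-rep n u))

  rep-+ : ∀ a b (u : List A) → rep (a + b) u ≡ rep a u ++ rep b u
  rep-+ zero    b u = refl
  rep-+ (suc a) b u = trans (cong (u ++_) (rep-+ a b u)) (sym (LP.++-assoc u (rep a u) (rep b u)))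

  rep-[] : ∀ n {u : List A} → length u ≡ 0 → rep n u ≡ []
  rep-[] zero    {[]} _ = refl
  rep-[] (suc n) {[]} _ = rep-[] n refl

  ++-rep-rotate : ∀ n (v w : List A) → v ++ rep n (w ++ v) ≡ rep n (v ++ w) ++ v
  ++-rep-rotate zero    v w = LP.++-identityʳ v
  ++-rep-rotate (suc n) v w = begin
    v ++ ((w ++ v) ++ rep n (w ++ v))   ≡⟨ cong (v ++_) (LP.++-assoc w v _) ⟩
    v ++ (w ++ (v ++ rep n (w ++ v)))   ≡⟨ cong (λ z → v ++ (w ++ z)) (++-rep-rotate n v w) ⟩
    v ++ (w ++ (rep n (v ++ w) ++ v))   ≡⟨ LP.++-assoc v w _ ⟨
    (v ++ w) ++ (rep n (v ++ w) ++ v)   ≡⟨ LP.++-assoc (v ++ w) _ v ⟨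
    ((v ++ w) ++ rep n (v ++ w)) ++ v   ∎
    where open ≡-Reasoning

  take-length-++ : ∀ (xs ys : List A) → take (length xs) (xs ++ ys) ≡ xs
  take-length-++ []       ys = refl
  take-length-++ (x ∷ xs) ys = cong (x ∷_) (take-length-++ xs ys)

  take-length+-++ : ∀ (xs : List A) n ys → take (length xs + n) (xs ++ ys) ≡ xs ++ take n ys
  take-length+-++ []       n ys = refl
  take-length+-++ (x ∷ xs) n ys = cong (x ∷_) (take-length+-++ xs n ys)

  take-++ˡ : ∀ n (xs ys : List A) → n ≤ length xs → take n (xs ++ ys) ≡ take n xs
  take-++ˡ zero    xs       ys _         = refl
  take-++ˡ (suc n) (x ∷ xs) ys (s≤s n≤) = cong (x ∷_) (take-++ˡ n xs ys n≤)

  private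
    take-rep-≤ : ∀ ℓ {a b} (u : List A) → a ≤ b → ℓ ≤ a * length u → take ℓ (rep a u) ≡ take ℓ (rep b u)
    take-rep-≤ ℓ {a} {b} u a≤b ℓ≤ = begin
      take ℓ (rep a u)                    ≡⟨ take-++ˡ ℓ (rep a u) _ (subst (ℓ ≤_) (sym (length-rep a u)) ℓ≤) ⟨
      take ℓ (rep a u ++ rep (b ∸ a) u)   ≡⟨ cong (take ℓ) (rep-+ a (b ∸ a) u) ⟨
      take ℓ (rep (a + (b ∸ a)) u)        ≡⟨ cong (λ c → take ℓ (rep c u)) (ℕP.m+[n∸m]≡n a≤b) ⟩
      take ℓ (rep b u)                    ∎
      where open ≡-Reasoning

  take-rep : ∀ ℓ {a b} (u : List A) → ℓ ≤ a * length u → ℓ ≤ b * length u → take ℓ (rep a u) ≡ take ℓ (rep b u)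
  take-rep ℓ {a} {b} u ℓ≤a ℓ≤b with ℕP.≤-total a b
  ... | inj₁ a≤b = take-rep-≤ ℓ u a≤b ℓ≤a
  ... | inj₂ b≤a = sym (take-rep-≤ ℓ u b≤a ℓ≤b)

module FractionalPower {k : ℕ} where
  open import Data.Nat using (suc; _+_; _*_; _≤_; _⊓_)
  import Data.Nat.Properties as ℕP
  open import Data.Integer using (∣_∣)
  open import Data.List using (_++_; take; length)
  import Data.List.Properties as LP
  open import Data.Product as Product using (Σ; _×_; _,_; proj₁; proj₂)
  open import Data.Rational as ℚ using (ℚ; ceiling)
  open import Relation.Binary.PropositionalEquality
  open import Defs
  open Exponent
  open Repetition

  fpow≡take-rep : ∀ (u : Word k) {p} ℓ K → Exp u p ℓ → ℓ ≤ K * length u → fpow u p ℓ ≡ take ℓ (rep K u)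
  fpow≡take-rep u {p} ℓ K (0≤p , e) = take-rep ℓ {∣ ceiling p ∣} {K} u (exponent≤ceiling {p} (length u) ℓ 0≤p e)

  length-fpow : ∀ (u : Word k) {p} ℓ → Exp u p ℓ → length (fpow u p ℓ) ≡ ℓ
  length-fpow u {p} ℓ (0≤p , e) = trans (LP.length-take ℓ (rep ∣ ceiling p ∣ u))
    (ℕP.m≤n⇒m⊓n≡m (subst (ℓ ≤_) (sym (length-rep ∣ ceiling p ∣ u)) (exponent≤ceiling (length u) ℓ 0≤p e)))

  take-rep-isFpow : ∀ (u : Word k) l K → l ≤ K * length u →
                    Σ ℚ λ m → Exp u m l × fpow u m l ≡ take l (rep K u)
  take-rep-isFpow u l K l≤ =
    Product.map₂ (λ {m} Em → Em , fpow≡take-rep u {m} l K Em l≤) (exponent-exists (length u) l L≡0⇒l≡0)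
    where
    L≡0⇒l≡0 : length u ≡ 0 → l ≡ 0
    L≡0⇒l≡0 L≡0 = ℕP.n≤0⇒n≡0 (subst (l ≤_) (trans (cong (K *_) L≡0) (ℕP.*-zeroʳ K)) l≤)

  prefix-of-++-fpow : ∀ (u : Word k) {p} ℓ y t → Exp u p ℓ → y ++ t ≡ u ++ fpow u p ℓ →
                      Σ ℚ λ m → Exp u m (length y) × y ≡ fpow u m (length y)
  prefix-of-++-fpow u {p} ℓ y t Ep y++t≡ = m , Em , trans y≡take (sym fpow≡take)
    where
    K = ∣ ceiling p ∣
    l = length y
    l≤ : l ≤ length u + ℓ
    l≤ = begin
      l                               ≤⟨ LP.length-++-≤ˡ y ⟩
      length (y ++ t)                 ≡⟨ cong length y++t≡ ⟩
      length (u ++ fpow u p ℓ)        ≡⟨ LP.length-++ u ⟩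
      length u + length (fpow u p ℓ)  ≡⟨ cong (length u +_) (length-fpow u ℓ Ep) ⟩
      length u + ℓ                    ∎
      where open ℕP.≤-Reasoning
    y≡take : y ≡ take l (rep (suc K) u)
    y≡take = begin
      y                                            ≡⟨ take-length-++ y t ⟨
      take l (y ++ t)                              ≡⟨ cong (take l) y++t≡ ⟩
      take l (u ++ take ℓ (rep K u))               ≡⟨ cong (take l) (take-length+-++ u ℓ (rep K u)) ⟨
      take l (take (length u + ℓ) (rep (suc K) u)) ≡⟨ LP.take-take l (length u + ℓ) _ ⟩
      take (l ⊓ (length u + ℓ)) (rep (suc K) u)    ≡⟨ cong (λ i → take i (rep (suc K) u)) (ℕP.m≤n⇒m⊓n≡m l≤) ⟩
      take l (rep (suc K) u)                       ∎
      where open ≡-Reasoning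
    isFpow : Σ ℚ λ m → Exp u m l × fpow u m l ≡ take l (rep (suc K) u)
    isFpow = take-rep-isFpow u l (suc K)
      (ℕP.≤-trans l≤ (ℕP.+-monoʳ-≤ (length u) (exponent≤ceiling {p} (length u) ℓ (proj₁ Ep) (proj₂ Ep))))
    m = proj₁ isFpow
    Em = proj₁ (proj₂ isFpow)
    fpow≡take = proj₂ (proj₂ isFpow)

  fpow-+ : ∀ (u : Word k) {p} ℓ ℓ′ n → Exp u p ℓ → Exp u (p ℚ.+ fromℕ n) ℓ′ →
           fpow u (p ℚ.+ fromℕ n) ℓ′ ≡ rep n u ++ fpow u p ℓ
  fpow-+ u {p} ℓ ℓ′ n Ep Ep′ =
    trans (fpow≡take-rep u ℓ′ (n + K) Ep′ ℓ′≤)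
      (trans (cong₂ take (trans ℓ′≡ (cong (_+ ℓ) (sym (length-rep n u)))) (rep-+ n K u))
        (take-length+-++ (rep n u) ℓ (rep K u)))
    where
    K = ∣ ceiling p ∣
    ℓ′≡ : ℓ′ ≡ n * length u + ℓ
    ℓ′≡ = exponent-+ {p} (length u) ℓ ℓ′ n (proj₂ Ep) (proj₂ Ep′)
    ℓ′≤ : ℓ′ ≤ (n + K) * length u
    ℓ′≤ = begin
      ℓ′                             ≡⟨ ℓ′≡ ⟩
      n * length u + ℓ               ≤⟨ ℕP.+-monoʳ-≤ (n * length u) (exponent≤ceiling {p} (length u) ℓ (proj₁ Ep) (proj₂ Ep)) ⟩
      n * length u + K * length u    ≡⟨ ℕP.*-distribʳ-+ (length u) n K ⟨
      (n + K) * length u             ∎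
      where open ℕP.≤-Reasoning

  fpow-sub : ∀ (u : Word k) {p} ℓ ℓ′ n → Exp u p ℓ → Exp u (p ℚ.- fromℕ n) ℓ′ →
           fpow u p ℓ ≡ rep n u ++ fpow u (p ℚ.- fromℕ n) ℓ′
  fpow-sub u {p} ℓ ℓ′ n Ep Ep′ = subst (λ q → fpow u q ℓ ≡ rep n u ++ fpow u (p ℚ.- fromℕ n) ℓ′) p-n+n≡p
    (fpow-+ u {p ℚ.- fromℕ n} ℓ′ ℓ n Ep′ (subst (λ q → Exp u q ℓ) (sym p-n+n≡p) Ep))
    where
    p-n+n≡p : p ℚ.- fromℕ n ℚ.+ fromℕ n ≡ p
    p-n+n≡p = -+-cancel p (fromℕ n)

module Predecessor {k : ℕ} where
  open import Defs
  open import Data.Nat using (suc; _+_; _*_; _≤_; _<_; z≤n; s≤s)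
  import Data.Nat.Properties as ℕP
  import Data.Fin.Properties as FinP
  open import Data.List using (List; []; _∷_; _++_; length)
  import Data.List.Properties as LP
  open import Data.List.Relation.Binary.Sublist.Propositional
    using (_⊆_; _∷_; _∷ʳ_; ⊆-refl; ⊆-trans; ⊆-antisym)
  open import Data.List.Relation.Binary.Sublist.Propositional.Properties
    using (++⁺; ++⁺ˡ; length-mono-≤; []⊆-universal)
  open import Data.List.Relation.Binary.Sublist.DecPropositional (FinP._≟_ {k}) using (_⊆?_)
  open import Relation.Nullary using (yes; no)
  open import Data.Empty using (⊥-elim)
  open import Data.Sum using (_⊎_; inj₁; inj₂)
  open import Data.Product using (Σ; _×_; _,_; proj₁; proj₂)
  open import Relation.Binary.PropositionalEquality
  open Repetition

  unsend : Word k → Word k → Word k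
  unsend v []      = []
  unsend v (c ∷ y) with c ∷ y ⊆? v
  ... | yes _ = []
  ... | no  _ = c ∷ unsend v y

  unsend-split : ∀ v y → Σ (Word k) λ y₂ → (y ≡ unsend v y ++ y₂) × (y₂ ⊆ v)
  unsend-split v []      = [] , refl , []⊆-universal v
  unsend-split v (c ∷ y) with c ∷ y ⊆? v
  ... | yes c∷y⊆v = c ∷ y , refl , c∷y⊆v
  ... | no  _ with unsend-split v y
  ...   | y₂ , eq , y₂⊆v = y₂ , cong (c ∷_) eq , y₂⊆v

  unsend-⊆ : ∀ v y → y ⊆ v → unsend v y ≡ []
  unsend-⊆ v []      _   = refl
  unsend-⊆ v (c ∷ y) y⊆v with c ∷ y ⊆? v
  ... | yes _    = refl
  ... | no  y⊈v = ⊥-elim (y⊈v y⊆v)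

  unsend≡[]⇒⊆ : ∀ v y → unsend v y ≡ [] → y ⊆ v
  unsend≡[]⇒⊆ v y eq with unsend-split v y
  ... | y₂ , y≡ , y₂⊆v = subst (_⊆ v) (sym (trans y≡ (cong (_++ y₂) eq))) y₂⊆v

  unsend-++-⊆ : ∀ v a b → b ⊆ v → unsend v (a ++ b) ⊆ a
  unsend-++-⊆ v []      b b⊆v rewrite unsend-⊆ v b b⊆v = ⊆-refl
  unsend-++-⊆ v (c ∷ a) b b⊆v with c ∷ a ++ b ⊆? v
  ... | yes _ = []⊆-universal _
  ... | no  _ = refl ∷ unsend-++-⊆ v a b b⊆v

  length-unsend-≤ : ∀ v y → length (unsend v y) ≤ length y
  length-unsend-≤ v y with unsend-split v y
  ... | y₂ , y≡ , _ = ℕP.≤-trans (ℕP.m≤m+n _ (length y₂))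
    (ℕP.≤-reflexive (trans (sym (LP.length-++ (unsend v y))) (cong length (sym y≡))))

  unsend-++ : ∀ v t c → 0 < length (unsend v c) → unsend v (t ++ c) ≡ t ++ unsend v c
  unsend-++ v []      c _   = refl
  unsend-++ v (x ∷ t) c pos with x ∷ t ++ c ⊆? v
  ... | yes x∷t++c⊆v =
    ⊥-elim (ℕP.<-irrefl (cong length (sym (unsend-⊆ v c (⊆-trans (++⁺ˡ (x ∷ t) ⊆-refl) x∷t++c⊆v)))) pos)
  ... | no  _        = cong (x ∷_) (unsend-++ v t c pos)

  unsend-++-nonempty : ∀ v t c → length t < length (unsend v (t ++ c)) → 0 < length (unsend v c)
  unsend-++-nonempty v t c long with unsend v c in eq
  ... | _ ∷ _ = s≤s z≤n
  ... | []    = ⊥-elim (ℕP.<-irrefl refl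
    (ℕP.<-≤-trans long (length-mono-≤ (unsend-++-⊆ v t c (unsend≡[]⇒⊆ v c eq)))))

  ⊆-++-split : ∀ {A : Set} (z v y : List A) → y ⊆ z ++ v →
               Σ (List A) λ a → Σ (List A) λ b → (y ≡ a ++ b) × (a ⊆ z) × (b ⊆ v)
  ⊆-++-split []      v y       y⊆v        = [] , y , refl , ⊆-refl , y⊆v
  ⊆-++-split (c ∷ z) v y       (.c ∷ʳ y⊆) with ⊆-++-split z v y y⊆
  ... | a , b , eq , a⊆z , b⊆v = a , b , eq , c ∷ʳ a⊆z , b⊆v
  ⊆-++-split (c ∷ z) v (.c ∷ y) (refl ∷ y⊆) with ⊆-++-split z v y y⊆
  ... | a , b , eq , a⊆z , b⊆v = c ∷ a , b , cong (c ∷_) eq , refl ∷ a⊆z , b⊆v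

  ⊆-++⇒unsend-⊆ : ∀ v y z → y ⊆ z ++ v → unsend v y ⊆ z
  ⊆-++⇒unsend-⊆ v y z y⊆ with ⊆-++-split z v y y⊆
  ... | a , b , refl , a⊆z , b⊆v = ⊆-trans (unsend-++-⊆ v a b b⊆v) a⊆z

  unsend-⊆⇒⊆-++ : ∀ v y z → unsend v y ⊆ z → y ⊆ z ++ v
  unsend-⊆⇒⊆-++ v y z unsend⊆ with unsend-split v y
  ... | y₂ , y≡ , y₂⊆v = subst (_⊆ z ++ v) (sym y≡) (++⁺ unsend⊆ y₂⊆v)

  pr₁ : Act k → Word k → Word k
  pr₁ (snd v) y = unsend v y
  pr₁ (rcv v) y = v ++ y

  pr : List (Act k) → Word k → Word k
  pr []      x = x
  pr (a ∷ σ) x = pr₁ a (pr σ x)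

  Step⇒pr₁-⊆ : ∀ a y z w → Step a z w → y ⊆ w → pr₁ a y ⊆ z
  Step⇒pr₁-⊆ (snd v) y z w step y⊆w = ⊆-++⇒unsend-⊆ v y z (⊆-trans y⊆w step)
  Step⇒pr₁-⊆ (rcv v) y z w step y⊆w = ⊆-trans (++⁺ (⊆-refl {x = v}) y⊆w) step

  pr₁-⊆⇒Step : ∀ a y z → pr₁ a y ⊆ z → Step a z y
  pr₁-⊆⇒Step (snd v) y z = unsend-⊆⇒⊆-++ v y z
  pr₁-⊆⇒Step (rcv v) y z pr⊆ = pr⊆

  pr-isPr : ∀ σ x → IsPr σ x (pr σ x)
  pr-isPr []      x z = (λ { (x′ , x⊆x′ , refl) → x⊆x′ }) , (λ x⊆z → z , x⊆z , refl)
  pr-isPr (a ∷ σ) x z = sound , complete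
    where
    sound : (Σ _ λ x′ → (x ⊆ x′) × Steps (a ∷ σ) z x′) → pr₁ a (pr σ x) ⊆ z
    sound (x′ , x⊆x′ , w , step , steps) =
      Step⇒pr₁-⊆ a (pr σ x) z w step (proj₁ (pr-isPr σ x w) (x′ , x⊆x′ , steps))
    complete : pr₁ a (pr σ x) ⊆ z → Σ _ λ x′ → (x ⊆ x′) × Steps (a ∷ σ) z x′
    complete pr⊆z with proj₂ (pr-isPr σ x (pr σ x)) ⊆-refl
    ... | x′ , x⊆x′ , steps = x′ , x⊆x′ , pr σ x , pr₁-⊆⇒Step a (pr σ x) z pr⊆z , steps

  IsPr-unique : ∀ {σ : List (Act k)} {x y y′} → IsPr σ x y → IsPr σ x y′ → y ≡ y′
  IsPr-unique {y = y} {y′} p q = ⊆-antisym (proj₁ (p y′) (proj₂ (q y′) ⊆-refl)) (proj₁ (q y) (proj₂ (p y) ⊆-refl))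

  pr-prefix : ∀ σ x → Σ (Word k) λ t → pr σ x ++ t ≡ rea σ ++ x
  pr-prefix []          x = [] , LP.++-identityʳ x
  pr-prefix (snd v ∷ σ) x with pr-prefix σ x | unsend-split v (pr σ x)
  ... | t , eq | y₂ , y≡ , _ =
    y₂ ++ t , trans (sym (LP.++-assoc (unsend v (pr σ x)) y₂ t)) (trans (cong (_++ t) (sym y≡)) eq)
  pr-prefix (rcv v ∷ σ) x with pr-prefix σ x
  ... | t , eq = t , trans (LP.++-assoc v (pr σ x) t) (trans (cong (v ++_) eq) (sym (LP.++-assoc v (rea σ) x)))

  private
    pr-rep-++-rcv : ∀ n σ (r v : Word k) x →
      pr σ (rep n ((r ++ v) ++ rea σ) ++ x) ≡ rep n (rea σ ++ (r ++ v)) ++ pr σ x →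
      v ++ pr σ (rep n (r ++ (v ++ rea σ)) ++ x) ≡ rep n ((v ++ rea σ) ++ r) ++ (v ++ pr σ x)
    pr-rep-++-rcv n σ r v x ih = begin
      v ++ pr σ (rep n (r ++ (v ++ s)) ++ x)   ≡⟨ cong (λ w → v ++ pr σ (rep n w ++ x)) (LP.++-assoc r v s) ⟨
      v ++ pr σ (rep n ((r ++ v) ++ s) ++ x)   ≡⟨ cong (v ++_) ih ⟩
      v ++ (rep n (s ++ (r ++ v)) ++ c)         ≡⟨ cong (λ w → v ++ (rep n w ++ c)) (LP.++-assoc s r v) ⟨
      v ++ (rep n ((s ++ r) ++ v) ++ c)         ≡⟨ LP.++-assoc v _ c ⟨
      (v ++ rep n ((s ++ r) ++ v)) ++ c         ≡⟨ cong (_++ c) (++-rep-rotate n v (s ++ r)) ⟩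
      (rep n (v ++ (s ++ r)) ++ v) ++ c         ≡⟨ LP.++-assoc _ v c ⟩
      rep n (v ++ (s ++ r)) ++ (v ++ c)         ≡⟨ cong (λ w → rep n w ++ (v ++ c)) (LP.++-assoc v s r) ⟨
      rep n ((v ++ s) ++ r) ++ (v ++ c)         ∎
      where
      open ≡-Reasoning
      s = rea σ
      c = pr σ x

  -- A receive ?v moves v from the front of the period to its back, hence the rotation by r.
  pr-rep-++ : ∀ n σ (r : Word k) x → length (rea σ) < length (pr σ x) →
              pr σ (rep n (r ++ rea σ) ++ x) ≡ rep n (rea σ ++ r) ++ pr σ x
  pr-rep-++ n []          r x _ = cong (λ w → rep n w ++ x) (LP.++-identityʳ r)
  pr-rep-++ n (snd v ∷ σ) r x long =
    trans (cong (unsend v) (pr-rep-++ n σ r x (ℕP.<-≤-trans long (length-unsend-≤ v (pr σ x)))))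
          (unsend-++ v (rep n (rea σ ++ r)) (pr σ x) (ℕP.≤-<-trans z≤n long))
  pr-rep-++ n (rcv v ∷ σ) r x long = pr-rep-++-rcv n σ r v x (pr-rep-++ n σ (r ++ v) x long′)
    where
    long′ : length (rea σ) < length (pr σ x)
    long′ = ℕP.+-cancelˡ-< (length v) _ _ (subst₂ _<_ (LP.length-++ v) (LP.length-++ v) long)

  pr-rep-++′ : ∀ n σ (r : Word k) x →
               length (rea σ) + n * length (r ++ rea σ) < length (pr σ (rep n (r ++ rea σ) ++ x)) →
               pr σ (rep n (r ++ rea σ) ++ x) ≡ rep n (rea σ ++ r) ++ pr σ x
  pr-rep-++′ n []          r x _ = cong (λ w → rep n w ++ x) (LP.++-identityʳ r)
  pr-rep-++′ n (snd v ∷ σ) r x long = trans (cong (unsend v) ih) (unsend-++ v T c (unsend-++-nonempty v T c long′))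
    where
    s = rea σ
    T = rep n (s ++ r)
    c = pr σ x
    y = pr σ (rep n (r ++ s) ++ x)
    ih : y ≡ T ++ c
    ih = pr-rep-++′ n σ r x (ℕP.<-≤-trans long (length-unsend-≤ v y))
    length-T : length T ≡ n * length (r ++ s)
    length-T = trans (length-rep n (s ++ r)) (cong (n *_) (LP.length-++-comm s r))
    long′ : length T < length (unsend v (T ++ c))
    long′ = ℕP.≤-<-trans (ℕP.≤-trans (ℕP.≤-reflexive length-T) (ℕP.m≤n+m _ (length s)))
      (subst (λ w → length s + n * length (r ++ s) < length (unsend v w)) ih long)
  pr-rep-++′ n (rcv v ∷ σ) r x long = pr-rep-++-rcv n σ r v x (pr-rep-++′ n σ (r ++ v) x long′)
    where
    s = rea σ
    long₀ : length (v ++ s) + n * length ((r ++ v) ++ s) < length (v ++ pr σ (rep n ((r ++ v) ++ s) ++ x))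
    long₀ = subst (λ w → length (v ++ s) + n * length w < length (v ++ pr σ (rep n w ++ x)))
      (sym (LP.++-assoc r v s)) long
    long′ : length s + n * length ((r ++ v) ++ s) < length (pr σ (rep n ((r ++ v) ++ s) ++ x))
    long′ = ℕP.+-cancelˡ-< (length v) _ _
      (subst₂ _<_ (trans (cong (_+ n * length ((r ++ v) ++ s)) (LP.length-++ v)) (ℕP.+-assoc (length v) (length s) _))
        (LP.length-++ v) long₀)

  IsPr-rep-++ : ∀ (σ : List (Act k)) n {x y} → IsPr σ x y → length (rea σ) ≡ 0 ⊎ length (rea σ) < length y →
                IsPr σ (rep n (rea σ) ++ x) (rep n (rea σ) ++ y)
  IsPr-rep-++ σ n {x} {y} isPr (inj₁ L≡0) =
    subst₂ (IsPr σ) (cong (_++ x) (sym (rep-[] n L≡0))) (cong (_++ y) (sym (rep-[] n L≡0))) isPr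
  IsPr-rep-++ σ n {x} {y} isPr (inj₂ long) = subst (IsPr σ _) pumped (pr-isPr σ _)
    where
    y≡pr : y ≡ pr σ x
    y≡pr = IsPr-unique isPr (pr-isPr σ x)
    pumped : pr σ (rep n (rea σ) ++ x) ≡ rep n (rea σ) ++ y
    pumped = trans (pr-rep-++ n σ [] x (subst (λ w → length (rea σ) < length w) y≡pr long))
      (cong₂ (λ w z → rep n w ++ z) (LP.++-identityʳ (rea σ)) (sym y≡pr))

  IsPr-rep-++⁻¹ : ∀ (σ : List (Act k)) n {x y} → IsPr σ (rep n (rea σ) ++ x) (rep n (rea σ) ++ y) →
                  length (rea σ) ≡ 0 ⊎ suc n * length (rea σ) < length (rep n (rea σ) ++ y) →
                  IsPr σ x y
  IsPr-rep-++⁻¹ σ n {x} {y} isPr (inj₁ L≡0) =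
    subst₂ (IsPr σ) (cong (_++ x) (rep-[] n L≡0)) (cong (_++ y) (rep-[] n L≡0)) isPr
  IsPr-rep-++⁻¹ σ n {x} {y} isPr (inj₂ long) = subst (IsPr σ x) (sym y≡pr) (pr-isPr σ x)
    where
    u = rea σ
    pumped≡pr : rep n u ++ y ≡ pr σ (rep n u ++ x)
    pumped≡pr = IsPr-unique isPr (pr-isPr σ _)
    pr-pumped : pr σ (rep n u ++ x) ≡ rep n u ++ pr σ x
    pr-pumped = trans (pr-rep-++′ n σ [] x (subst (λ w → length u + n * length u < length w) pumped≡pr long))
      (cong (λ w → rep n w ++ pr σ x) (LP.++-identityʳ u))
    y≡pr : y ≡ pr σ x
    y≡pr = LP.++-cancelˡ (rep n u) y (pr σ x) (trans pumped≡pr pr-pumped)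

open import Defs
import Data.Nat as ℕ
import Data.Nat.Properties as ℕP
open import Data.Integer using (+_)
open import Data.List using (List; _++_; length)
open import Data.Product using (Σ; _×_; _,_; proj₂)
open import Data.Rational using (ℚ; _/_; _+_; _-_; _<_; 1ℚ)
import Data.Sum as Sum
open import Relation.Binary.PropositionalEquality using (_≡_; subst; subst₂; sym; trans; cong)
open Exponent using (exponent-<)
open Repetition using (rep)
open FractionalPower
open Predecessor

pr-fpow : ∀ {k} (σ : List (Act k)) (p : ℚ) (ℓ : ℕ) → Exp (rea σ) p ℓ →
          Σ ℚ λ m → Σ ℕ λ l → Exp (rea σ) m l × IsPr σ (fpow (rea σ) p ℓ) (fpow (rea σ) m l)
pr-fpow σ p ℓ Ep with pr-prefix σ (fpow (rea σ) p ℓ)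
... | t , y++t≡ with prefix-of-++-fpow (rea σ) ℓ (pr σ (fpow (rea σ) p ℓ)) t Ep y++t≡
...   | m , Em , y≡ = m , _ , Em , subst (IsPr σ _) y≡ (pr-isPr σ _)

pr-fpow-+ : ∀ {k} (σ : List (Act k)) (p : ℚ) (ℓ : ℕ) (m : ℚ) (l : ℕ) → Exp (rea σ) p ℓ → Exp (rea σ) m l →
            IsPr σ (fpow (rea σ) p ℓ) (fpow (rea σ) m l) → 1ℚ < m →
            ∀ (n : ℕ) (ℓ′ l′ : ℕ) →
            Exp (rea σ) (p + (+ n / 1)) ℓ′ → Exp (rea σ) (m + (+ n / 1)) l′ →
            IsPr σ (fpow (rea σ) (p + (+ n / 1)) ℓ′) (fpow (rea σ) (m + (+ n / 1)) l′)
pr-fpow-+ σ p ℓ m l Ep Em isPr 1<m n ℓ′ l′ Ep′ Em′ =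
  subst₂ (IsPr σ) (sym (fpow-+ u ℓ ℓ′ n Ep Ep′)) (sym (fpow-+ u l l′ n Em Em′)) (IsPr-rep-++ σ n isPr short)
  where
  u = rea σ
  short : length u ≡ 0 Sum.⊎ length u ℕ.< length (fpow u m l)
  short = Sum.map₂ (subst₂ ℕ._<_ (ℕP.*-identityˡ (length u)) (sym (length-fpow u l Em)))
    (exponent-< 1 (length u) l 1<m (proj₂ Em))

pr-fpow-sub : ∀ {k} (σ : List (Act k)) (p : ℚ) (ℓ : ℕ) (m : ℚ) (l : ℕ) → Exp (rea σ) p ℓ → Exp (rea σ) m l →
            IsPr σ (fpow (rea σ) p ℓ) (fpow (rea σ) m l) →
            ∀ (n : ℕ) → (+ suc n / 1) < m →
            ∀ (ℓ′ l′ : ℕ) →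
            Exp (rea σ) (p - (+ n / 1)) ℓ′ → Exp (rea σ) (m - (+ n / 1)) l′ →
            IsPr σ (fpow (rea σ) (p - (+ n / 1)) ℓ′) (fpow (rea σ) (m - (+ n / 1)) l′)
pr-fpow-sub σ p ℓ m l Ep Em isPr n n+1<m ℓ′ l′ Ep′ Em′ =
  IsPr-rep-++⁻¹ σ n (subst₂ (IsPr σ) (fpow-sub u ℓ ℓ′ n Ep Ep′) fpow-m≡ isPr) long
  where
  u = rea σ
  fpow-m≡ = fpow-sub u l l′ n Em Em′
  long : length u ≡ 0 Sum.⊎ suc n ℕ.* length u ℕ.< length (rep n u ++ fpow u (m - (+ n / 1)) l′)
  long = Sum.map₂ (subst (suc n ℕ.* length u ℕ.<_) (trans (sym (length-fpow u l Em)) (cong length fpow-m≡)))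
    (exponent-< (suc n) (length u) l n+1<m (proj₂ Em))

lemma6 : (k : ℕ) (σ : List (Act k)) →
    -- (i)
    (∀ (p : ℚ) (ℓ : ℕ) → Exp (rea σ) p ℓ →
       Σ ℚ λ m → Σ ℕ λ l → Exp (rea σ) m l × IsPr σ (fpow (rea σ) p ℓ) (fpow (rea σ) m l))
    -- (ii)
    × (∀ (p : ℚ) (ℓ : ℕ) (m : ℚ) (l : ℕ) → Exp (rea σ) p ℓ → Exp (rea σ) m l →
       IsPr σ (fpow (rea σ) p ℓ) (fpow (rea σ) m l) → 1ℚ < m →
       ∀ (n : ℕ) (ℓ′ l′ : ℕ) →
         Exp (rea σ) (p + (+ n / 1)) ℓ′ → Exp (rea σ) (m + (+ n / 1)) l′ →
         IsPr σ (fpow (rea σ) (p + (+ n / 1)) ℓ′) (fpow (rea σ) (m + (+ n / 1)) l′))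
    -- (iii)
    × (∀ (p : ℚ) (ℓ : ℕ) (m : ℚ) (l : ℕ) → Exp (rea σ) p ℓ → Exp (rea σ) m l →
       IsPr σ (fpow (rea σ) p ℓ) (fpow (rea σ) m l) →
       ∀ (n : ℕ) → (+ suc n / 1) < m →
       ∀ (ℓ′ l′ : ℕ) →
         Exp (rea σ) (p - (+ n / 1)) ℓ′ → Exp (rea σ) (m - (+ n / 1)) l′ →
         IsPr σ (fpow (rea σ) (p - (+ n / 1)) ℓ′) (fpow (rea σ) (m - (+ n / 1)) l′))
lemma6 k σ = pr-fpow σ , pr-fpow-+ σ , pr-fpow-sub σ
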